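{- Let $(\mathcal D,\otimes,I)$ be a symmetric monoidal closed category with countable coproducts and binary products, let $X,Y$ be objects of $\mathcal D$, and let $X^*$, $m_X$, $i_X$, $\eta_X$ be as in the context. Consider the endofunctor $TQ=Y\times[X,Q]$ on $\mathcal D$ and equip the object $[X^*,Y]$ with the $T$-coalgebra structure $\langle f_{[X^*,Y]},\tau_{[X^*,Y]}\rangle$, where $\tau_{[X^*,Y]}:[X^*,Y]\to[X,[X^*,Y]]$ is the two-fold currying of $$[X^*,Y]\otimes X\otimes X^*\xrightarrow{[X^*,Y]\otimes\eta_X\otimes X^*}[X^*,Y]\otimes X^*\otimes X^*\xrightarrow{[X^*,Y]\otimes m_X}[X^*,Y]\otimes X^*\xrightarrow{\mathrm{ev}}Y,$$ and $f_{[X^*,Y]}$ is the composite $[X^*,Y]\cong[X^*,Y]\otimes I\xrightarrow{[X^*,Y]\otimes i_X}[X^*,Y]\otimes X^*\xrightarrow{\mathrm{ev}}Y$. Then $([X^*,Y],\tau_{[X^*,Y]},f_{[X^*,Y]})$ is a final $T$-coalgebra.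
   Context: In a symmetric monoidal closed category, $[A,-]$ denotes the right adjoint of $-\otimes A$ and $\mathrm{ev}:[A,B]\otimes A\to B$ the counit (evaluation); "currying" refers to this adjunction. $X^{\otimes n}$ is the $n$-fold tensor power ($X^{\otimes 0}=I$, $X^{\otimes(n+1)}=X\otimes X^{\otimes n}$), and $X^*=\coprod_{n<\omega}X^{\otimes n}$ is the free monoid (monoid object) on $X$: its unit $i_X:I\to X^*$ is the $0$-th coproduct injection, its multiplication $m_X:X^*\otimes X^*\cong\coprod_{n,k}X^{\otimes n}\otimes X^{\otimes k}\to X^*$ has as $(n,k)$-component the $(n+k)$-th coproduct injection, and $\eta_X:X\to X^*$ is the first coproduct injection. A $T$-coalgebra is an object $Q$ with a morphism $Q\to TQ$, i.e. a pair $\tau:Q\to[X,Q]$, $f:Q\to Y$; a homomorphism $h:(Q,\tau,f)\to(Q',\tau',f')$ satisfies $f'\circ h=f$ and $\tau'\circ h=[X,h]\circ\tau$. Final means every $T$-coalgebra has exactly one homomorphism into it. -}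

module Defs where

open import Level using (Level; _⊔_) renaming (suc to lsuc)
open import Data.Nat using (ℕ; zero; suc; _+_)
open import Data.Product using (Σ; _,_)
open import Relation.Binary using (IsEquivalence)

record Category (o ℓ e : Level) : Set (lsuc (o ⊔ ℓ ⊔ e)) where
  infix  4 _≈_
  infixr 9 _∘_
  infix  5 _⇒_
  field
    Obj       : Set o
    _⇒_       : Obj → Obj → Set ℓ
    _≈_       : ∀ {A B} → A ⇒ B → A ⇒ B → Set e
    id        : ∀ {A} → A ⇒ A
    _∘_       : ∀ {A B C} → B ⇒ C → A ⇒ B → A ⇒ C
    ≈-equiv   : ∀ {A B} → IsEquivalence (_≈_ {A} {B})
    ∘-resp-≈  : ∀ {A B C} {f h : B ⇒ C} {g i : A ⇒ B} →
                f ≈ h → g ≈ i → f ∘ g ≈ h ∘ i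
    assoc     : ∀ {A B C D} {f : A ⇒ B} {g : B ⇒ C} {h : C ⇒ D} →
                (h ∘ g) ∘ f ≈ h ∘ (g ∘ f)
    identityˡ : ∀ {A B} {f : A ⇒ B} → id ∘ f ≈ f
    identityʳ : ∀ {A B} {f : A ⇒ B} → f ∘ id ≈ f

record SymmetricMonoidalClosed {o ℓ e} (𝒞 : Category o ℓ e) : Set (o ⊔ ℓ ⊔ e) where
  open Category 𝒞
  infixr 10 _⊗₀_ _⊗₁_
  field
    _⊗₀_ : Obj → Obj → Obj
    _⊗₁_ : ∀ {A B C D} → A ⇒ B → C ⇒ D → (A ⊗₀ C) ⇒ (B ⊗₀ D)
    ⊗-identity     : ∀ {A B} → id {A} ⊗₁ id {B} ≈ id
    ⊗-homomorphism : ∀ {A B C D E F} {f : A ⇒ B} {g : B ⇒ C} {h : D ⇒ E} {k : E ⇒ F} →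
                     (g ∘ f) ⊗₁ (k ∘ h) ≈ (g ⊗₁ k) ∘ (f ⊗₁ h)
    ⊗-resp-≈       : ∀ {A B C D} {f f' : A ⇒ B} {g g' : C ⇒ D} →
                     f ≈ f' → g ≈ g' → f ⊗₁ g ≈ f' ⊗₁ g'
    unit : Obj
    λ⇒ : ∀ {A} → unit ⊗₀ A ⇒ A
    λ⇐ : ∀ {A} → A ⇒ unit ⊗₀ A
    λ-isoˡ : ∀ {A} → λ⇐ {A} ∘ λ⇒ ≈ id
    λ-isoʳ : ∀ {A} → λ⇒ {A} ∘ λ⇐ ≈ id
    λ-natural : ∀ {A B} {f : A ⇒ B} → λ⇒ ∘ (id ⊗₁ f) ≈ f ∘ λ⇒
    ρ⇒ : ∀ {A} → A ⊗₀ unit ⇒ A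
    ρ⇐ : ∀ {A} → A ⇒ A ⊗₀ unit
    ρ-isoˡ : ∀ {A} → ρ⇐ {A} ∘ ρ⇒ ≈ id
    ρ-isoʳ : ∀ {A} → ρ⇒ {A} ∘ ρ⇐ ≈ id
    ρ-natural : ∀ {A B} {f : A ⇒ B} → ρ⇒ ∘ (f ⊗₁ id) ≈ f ∘ ρ⇒
    α⇒ : ∀ {A B C} → (A ⊗₀ B) ⊗₀ C ⇒ A ⊗₀ (B ⊗₀ C)
    α⇐ : ∀ {A B C} → A ⊗₀ (B ⊗₀ C) ⇒ (A ⊗₀ B) ⊗₀ C
    α-isoˡ : ∀ {A B C} → α⇐ {A} {B} {C} ∘ α⇒ ≈ id
    α-isoʳ : ∀ {A B C} → α⇒ {A} {B} {C} ∘ α⇐ ≈ id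
    α-natural : ∀ {A A' B B' C C'} {f : A ⇒ A'} {g : B ⇒ B'} {h : C ⇒ C'} →
                α⇒ ∘ ((f ⊗₁ g) ⊗₁ h) ≈ (f ⊗₁ (g ⊗₁ h)) ∘ α⇒
    triangle : ∀ {A B} → (id {A} ⊗₁ λ⇒ {B}) ∘ α⇒ ≈ ρ⇒ ⊗₁ id
    pentagon : ∀ {A B C D} →
               (id {A} ⊗₁ α⇒ {B} {C} {D}) ∘ α⇒ ∘ (α⇒ ⊗₁ id) ≈ α⇒ ∘ α⇒
    σ : ∀ {A B} → A ⊗₀ B ⇒ B ⊗₀ A
    σ-natural    : ∀ {A A' B B'} {f : A ⇒ A'} {g : B ⇒ B'} →
                   σ ∘ (f ⊗₁ g) ≈ (g ⊗₁ f) ∘ σ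
    σ-involutive : ∀ {A B} → σ {B} {A} ∘ σ {A} {B} ≈ id
    hexagon      : ∀ {A B C} →
                   α⇒ ∘ σ {A} {B ⊗₀ C} ∘ α⇒ ≈ (id ⊗₁ σ) ∘ α⇒ ∘ (σ ⊗₁ id)
    [_,_] : Obj → Obj → Obj
    ev    : ∀ {A B} → [ A , B ] ⊗₀ A ⇒ B
    curry : ∀ {A B C} → C ⊗₀ A ⇒ B → C ⇒ [ A , B ]
    curry-β      : ∀ {A B C} {f : C ⊗₀ A ⇒ B} → ev ∘ (curry f ⊗₁ id) ≈ f
    curry-unique : ∀ {A B C} {f : C ⊗₀ A ⇒ B} {g : C ⇒ [ A , B ]} →
                   ev ∘ (g ⊗₁ id) ≈ f → g ≈ curry f

record CountableCoproducts {o ℓ e} (𝒞 : Category o ℓ e) : Set (o ⊔ ℓ ⊔ e) where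
  open Category 𝒞
  field
    ∐       : (ℕ → Obj) → Obj
    ι       : ∀ {A : ℕ → Obj} (n : ℕ) → A n ⇒ ∐ A
    copair  : ∀ {A : ℕ → Obj} {B} → ((n : ℕ) → A n ⇒ B) → ∐ A ⇒ B
    copair-β      : ∀ {A : ℕ → Obj} {B} {h : (n : ℕ) → A n ⇒ B} (n : ℕ) →
                    copair h ∘ ι n ≈ h n
    copair-unique : ∀ {A : ℕ → Obj} {B} {h : (n : ℕ) → A n ⇒ B} {g : ∐ A ⇒ B} →
                    ((n : ℕ) → g ∘ ι n ≈ h n) → g ≈ copair h

record BinaryProducts {o ℓ e} (𝒞 : Category o ℓ e) : Set (o ⊔ ℓ ⊔ e) where
  open Category 𝒞
  infixr 7 _×_
  field
    _×_   : Obj → Obj → Obj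
    π₁    : ∀ {A B} → A × B ⇒ A
    π₂    : ∀ {A B} → A × B ⇒ B
    ⟨_,_⟩ : ∀ {A B C} → C ⇒ A → C ⇒ B → C ⇒ A × B
    π₁-β  : ∀ {A B C} {f : C ⇒ A} {g : C ⇒ B} → π₁ ∘ ⟨ f , g ⟩ ≈ f
    π₂-β  : ∀ {A B C} {f : C ⇒ A} {g : C ⇒ B} → π₂ ∘ ⟨ f , g ⟩ ≈ g
    ⟨⟩-unique : ∀ {A B C} {f : C ⇒ A} {g : C ⇒ B} {h : C ⇒ A × B} →
                π₁ ∘ h ≈ f → π₂ ∘ h ≈ g → h ≈ ⟨ f , g ⟩

module Construction {o ℓ e} (𝒞 : Category o ℓ e)
                    (M : SymmetricMonoidalClosed 𝒞)
                    (K : CountableCoproducts 𝒞)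
                    (X Y : Category.Obj 𝒞) where
  open Category 𝒞
  open SymmetricMonoidalClosed M
  open CountableCoproducts K

  [X,_]₁ : ∀ {A B} → A ⇒ B → [ X , A ] ⇒ [ X , B ]
  [X, h ]₁ = curry (h ∘ ev)

  pow : ℕ → Obj
  pow zero    = unit
  pow (suc n) = X ⊗₀ pow n

  app : (n k : ℕ) → pow n ⊗₀ pow k ⇒ pow (n + k)
  app zero    k = λ⇒
  app (suc n) k = (id ⊗₁ app n k) ∘ α⇒

  X* : Obj
  X* = ∐ pow

  iX : unit ⇒ X*
  iX = ι 0

  ηX : X ⇒ X*
  ηX = ι 1 ∘ ρ⇐

  -- multiplication: the unique map X*⊗X* → X* whose (n,k)-component
  -- X^{⊗n}⊗X^{⊗k} → X* is ι (n+k) ∘ app n k.  Constructed using that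
  -- - ⊗ A is a left adjoint (curry/ev) and the symmetry.
  mulₙ : (n : ℕ) → pow n ⊗₀ X* ⇒ X*
  mulₙ n = ev ∘ (copair (λ k → curry (ι (n + k) ∘ app n k ∘ σ)) ⊗₁ id) ∘ σ

  mX : X* ⊗₀ X* ⇒ X*
  mX = ev ∘ (copair (λ n → curry (mulₙ n)) ⊗₁ id)

  -- T-coalgebras for T Q = Y × [X,Q], presented as pairs (τ , f)
  record Coalg : Set (o ⊔ ℓ) where
    constructor coalg
    field
      Q : Obj
      τ : Q ⇒ [ X , Q ]
      f : Q ⇒ Y

  record CoalgHom (A B : Coalg) : Set (ℓ ⊔ e) where
    private
      module A = Coalg A
      module B = Coalg B
    field
      h     : A.Q ⇒ B.Q
      f-hom : B.f ∘ h ≈ A.f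
      τ-hom : B.τ ∘ h ≈ [X, h ]₁ ∘ A.τ

  IsFinal : Coalg → Set (o ⊔ ℓ ⊔ e)
  IsFinal Z = (A : Coalg) →
              Σ (CoalgHom A Z) (λ _ →
                 (g g' : CoalgHom A Z) → CoalgHom.h g ≈ CoalgHom.h g')

  W : Obj
  W = [ X* , Y ]

  τW : W ⇒ [ X , W ]
  τW = curry (curry (ev ∘ (id ⊗₁ mX) ∘ α⇒ ∘ ((id ⊗₁ ηX) ⊗₁ id)))

  fW : W ⇒ Y
  fW = ev ∘ (id ⊗₁ iX) ∘ ρ⇐

  wordCoalg : Coalg
  wordCoalg = coalg W τW fW

module Submission where

-- Because - ⊗ A is a left adjoint, A ⊗ X* = A ⊗ ∐ₙ X^{⊗n} is again a
-- coproduct of the A ⊗ X^{⊗n}.  Hence a map k : Q → [X*,Y] is the same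
-- thing as its family of components  Q ⊗ X^{⊗n} → Y  (restrictions of
-- the transpose of k to words of length n).  Transposing the two
-- homomorphism equations shows that k is a homomorphism from (Q,τ,f)
-- exactly when its components satisfy the recursion
--     comp 0 = f ∘ ρ⇒ ,   comp (n+1) = comp n ∘ (uncurry τ ⊗ id) ∘ α⇐ ,
-- which has exactly one solution, the behaviour of (Q,τ,f).  Copairing
-- the behaviour gives the homomorphism; uniqueness is the fact that
-- components determine a map.

open import Data.Nat using (ℕ; zero; suc; _+_)
open import Data.Product using (_,_)
open import Relation.Binary.Bundles using (Setoid)
import Relation.Binary.Reasoning.Setoid as SetoidReasoning
open import Defs

module CategoryReasoning {o ℓ e} (𝒞 : Category o ℓ e) where
  open Category 𝒞

  hom-setoid : Obj → Obj → Setoid ℓ e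
  hom-setoid A B = record { Carrier = A ⇒ B ; _≈_ = _≈_ ; isEquivalence = ≈-equiv }

  module _ {A B : Obj} where
    open Setoid (hom-setoid A B) public using (refl; sym; trans)
    open SetoidReasoning (hom-setoid A B) public

  infixr 4 _⟩∘⟨_ refl⟩∘⟨_
  infixl 5 _⟩∘⟨refl

  _⟩∘⟨_ : ∀ {A B C} {f h : B ⇒ C} {g i : A ⇒ B} → f ≈ h → g ≈ i → f ∘ g ≈ h ∘ i
  _⟩∘⟨_ = ∘-resp-≈

  refl⟩∘⟨_ : ∀ {A B C} {f : B ⇒ C} {g i : A ⇒ B} → g ≈ i → f ∘ g ≈ f ∘ i
  refl⟩∘⟨ p = refl ⟩∘⟨ p

  _⟩∘⟨refl : ∀ {A B C} {f h : B ⇒ C} {g : A ⇒ B} → f ≈ h → f ∘ g ≈ h ∘ g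
  p ⟩∘⟨refl = p ⟩∘⟨ refl

  assoc² : ∀ {A B C D E} {a : D ⇒ E} {b : C ⇒ D} {c : B ⇒ C} {d : A ⇒ B} →
           (a ∘ (b ∘ c)) ∘ d ≈ a ∘ (b ∘ (c ∘ d))
  assoc² = trans assoc (refl⟩∘⟨ assoc)

  cancelʳ : ∀ {A B C} {f : B ⇒ C} {g : A ⇒ B} {h : B ⇒ A} →
            g ∘ h ≈ id → (f ∘ g) ∘ h ≈ f
  cancelʳ gh = trans assoc (trans (refl⟩∘⟨ gh) identityʳ)

  move-iso : ∀ {A B C} {f : B ⇒ C} {g : A ⇒ B} {h : B ⇒ A} {k : A ⇒ C} →
             g ∘ h ≈ id → f ∘ g ≈ k → f ≈ k ∘ h
  move-iso gh fg = sym (trans (sym fg ⟩∘⟨refl) (cancelʳ gh))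

module MonoidalClosedReasoning {o ℓ e} (𝒞 : Category o ℓ e)
                               (M : SymmetricMonoidalClosed 𝒞) where
  open Category 𝒞
  open SymmetricMonoidalClosed M
  open CategoryReasoning 𝒞

  ⊗-∘ : ∀ {A B C D E F} {f : B ⇒ C} {g : A ⇒ B} {h : E ⇒ F} {k : D ⇒ E} →
        (f ⊗₁ h) ∘ (g ⊗₁ k) ≈ (f ∘ g) ⊗₁ (h ∘ k)
  ⊗-∘ = sym ⊗-homomorphism

  ⊗id-∘-id⊗ : ∀ {A B C D} {f : A ⇒ B} {g : C ⇒ D} → (f ⊗₁ id) ∘ (id ⊗₁ g) ≈ f ⊗₁ g
  ⊗id-∘-id⊗ = trans ⊗-∘ (⊗-resp-≈ identityʳ identityˡ)

  id⊗-∘-⊗id : ∀ {A B C D} {f : A ⇒ B} {g : C ⇒ D} → (id ⊗₁ g) ∘ (f ⊗₁ id) ≈ f ⊗₁ g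
  id⊗-∘-⊗id = trans ⊗-∘ (⊗-resp-≈ identityˡ identityʳ)

  ⊗-interchange : ∀ {A B C D} {f : A ⇒ B} {g : C ⇒ D} →
                  (id ⊗₁ g) ∘ (f ⊗₁ id) ≈ (f ⊗₁ id) ∘ (id ⊗₁ g)
  ⊗-interchange = trans id⊗-∘-⊗id (sym ⊗id-∘-id⊗)

  ρ⇐-natural : ∀ {A B} {k : A ⇒ B} → ρ⇐ ∘ k ≈ (k ⊗₁ id) ∘ ρ⇐
  ρ⇐-natural {k = k} = move-iso ρ-isoʳ (begin
    (ρ⇐ ∘ k) ∘ ρ⇒            ≈⟨ assoc ⟩
    ρ⇐ ∘ k ∘ ρ⇒              ≈⟨ refl⟩∘⟨ ρ-natural ⟨
    ρ⇐ ∘ ρ⇒ ∘ (k ⊗₁ id)      ≈⟨ assoc ⟨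
    (ρ⇐ ∘ ρ⇒) ∘ (k ⊗₁ id)    ≈⟨ ρ-isoˡ ⟩∘⟨refl ⟩
    id ∘ (k ⊗₁ id)           ≈⟨ identityˡ ⟩
    k ⊗₁ id                  ∎)

  σ-cancel : ∀ {A B C} {u : A ⊗₀ B ⇒ C} → (u ∘ σ) ∘ σ ≈ u
  σ-cancel = cancelʳ σ-involutive

  uncurry : ∀ {A B C} → C ⇒ [ A , B ] → C ⊗₀ A ⇒ B
  uncurry a = ev ∘ (a ⊗₁ id)

  uncurry-cong : ∀ {A B C} {a b : C ⇒ [ A , B ]} → a ≈ b → uncurry a ≈ uncurry b
  uncurry-cong p = refl⟩∘⟨ ⊗-resp-≈ p refl

  uncurry-curry : ∀ {A B C} {f : C ⊗₀ A ⇒ B} → uncurry (curry f) ≈ f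
  uncurry-curry = curry-β

  uncurry-injective : ∀ {A B C} {a b : C ⇒ [ A , B ]} → uncurry a ≈ uncurry b → a ≈ b
  uncurry-injective p = trans (curry-unique p) (sym (curry-unique refl))

  curry-cong : ∀ {A B C} {f g : C ⊗₀ A ⇒ B} → f ≈ g → curry f ≈ curry g
  curry-cong p = curry-unique (trans curry-β p)

  uncurry-∘ : ∀ {A B C D} {a : C ⇒ [ A , B ]} {b : D ⇒ C} →
              uncurry (a ∘ b) ≈ uncurry a ∘ (b ⊗₁ id)
  uncurry-∘ = trans (refl⟩∘⟨ trans (⊗-resp-≈ refl (sym identityˡ)) ⊗-homomorphism)
                    (sym assoc)

  curry-∘ : ∀ {A B C D} {f : C ⊗₀ A ⇒ B} {g : D ⇒ C} →
            curry f ∘ g ≈ curry (f ∘ (g ⊗₁ id))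
  curry-∘ = curry-unique (trans uncurry-∘ (uncurry-curry ⟩∘⟨refl))

-- Tensoring with a countable coproduct.  Since - ⊗ A has a right adjoint and ⊗ is symmetric, A ⊗ ∐ B is a
-- coproduct of the objects A ⊗ B n with injections id ⊗ ι n.

module TensorCoproduct {o ℓ e} (𝒞 : Category o ℓ e) (M : SymmetricMonoidalClosed 𝒞)
                       (K : CountableCoproducts 𝒞) where
  open Category 𝒞
  open SymmetricMonoidalClosed M
  open CountableCoproducts K
  open CategoryReasoning 𝒞
  open MonoidalClosedReasoning 𝒞 M

  copair-cong : ∀ {A : ℕ → Obj} {B} {h h' : (n : ℕ) → A n ⇒ B} →
                ((n : ℕ) → h n ≈ h' n) → copair h ≈ copair h'
  copair-cong p = copair-unique (λ n → trans (copair-β n) (p n))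

  copairʳ : ∀ {A Z} {B : ℕ → Obj} → ((n : ℕ) → A ⊗₀ B n ⇒ Z) → A ⊗₀ ∐ B ⇒ Z
  copairʳ c = ev ∘ (copair (λ n → curry (c n ∘ σ)) ⊗₁ id) ∘ σ

  copairʳ-β : ∀ {A Z} {B : ℕ → Obj} {c : (n : ℕ) → A ⊗₀ B n ⇒ Z} (n : ℕ) →
              copairʳ c ∘ (id ⊗₁ ι n) ≈ c n
  copairʳ-β {A} {Z} {B} {c} n = begin
    copairʳ c ∘ (id ⊗₁ ι n)            ≈⟨ trans assoc² (sym assoc) ⟩
    uncurry γ ∘ σ ∘ (id ⊗₁ ι n)        ≈⟨ refl⟩∘⟨ σ-natural ⟩
    uncurry γ ∘ (ι n ⊗₁ id) ∘ σ        ≈⟨ assoc ⟨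
    (uncurry γ ∘ (ι n ⊗₁ id)) ∘ σ      ≈⟨ sym uncurry-∘ ⟩∘⟨refl ⟩
    uncurry (γ ∘ ι n) ∘ σ              ≈⟨ uncurry-cong (copair-β n) ⟩∘⟨refl ⟩
    uncurry (curry (c n ∘ σ)) ∘ σ      ≈⟨ uncurry-curry ⟩∘⟨refl ⟩
    (c n ∘ σ) ∘ σ                      ≈⟨ σ-cancel ⟩
    c n                                ∎
    where
    γ : ∐ B ⇒ [ A , Z ]
    γ = copair (λ n → curry (c n ∘ σ))

  copairʳ-unique : ∀ {A Z} {B : ℕ → Obj} {c : (n : ℕ) → A ⊗₀ B n ⇒ Z}
                   {w : A ⊗₀ ∐ B ⇒ Z} →
                   ((n : ℕ) → w ∘ (id ⊗₁ ι n) ≈ c n) → w ≈ copairʳ c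
  copairʳ-unique {c = c} {w} hyp = begin
    w                                  ≈⟨ σ-cancel ⟨
    (w ∘ σ) ∘ σ                        ≈⟨ uncurry-curry ⟩∘⟨refl ⟨
    uncurry (curry (w ∘ σ)) ∘ σ        ≈⟨ uncurry-cong transpose-is-copair ⟩∘⟨refl ⟩
    uncurry (copair (λ n → curry (c n ∘ σ))) ∘ σ   ≈⟨ assoc ⟩
    copairʳ c                          ∎
    where
    restrict : (n : ℕ) → curry (w ∘ σ) ∘ ι n ≈ curry (c n ∘ σ)
    restrict n = begin
      curry (w ∘ σ) ∘ ι n              ≈⟨ curry-∘ ⟩
      curry ((w ∘ σ) ∘ (ι n ⊗₁ id))    ≈⟨ curry-cong (trans assoc (refl⟩∘⟨ σ-natural)) ⟩
      curry (w ∘ (id ⊗₁ ι n) ∘ σ)      ≈⟨ curry-cong (trans (sym assoc) (hyp n ⟩∘⟨refl)) ⟩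
      curry (c n ∘ σ)                  ∎
    transpose-is-copair : curry (w ∘ σ) ≈ copair (λ n → curry (c n ∘ σ))
    transpose-is-copair = copair-unique restrict

  tensor-jointly-epic : ∀ {A Z} {B : ℕ → Obj} {u v : A ⊗₀ ∐ B ⇒ Z} →
                        ((n : ℕ) → u ∘ (id ⊗₁ ι n) ≈ v ∘ (id ⊗₁ ι n)) → u ≈ v
  tensor-jointly-epic agree =
    trans (copairʳ-unique agree) (sym (copairʳ-unique (λ _ → refl)))

module WordCoalgebra {o ℓ e} (𝒞 : Category o ℓ e) (M : SymmetricMonoidalClosed 𝒞)
                     (K : CountableCoproducts 𝒞) (X Y : Category.Obj 𝒞) where
  open Category 𝒞
  open SymmetricMonoidalClosed M
  open CountableCoproducts K
  open CategoryReasoning 𝒞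
  open MonoidalClosedReasoning 𝒞 M
  open TensorCoproduct 𝒞 M K
  open Construction 𝒞 M K X Y

  mulₙ-β : (n k : ℕ) → mulₙ n ∘ (id ⊗₁ ι k) ≈ ι (n + k) ∘ app n k
  mulₙ-β n k = begin
    mulₙ n ∘ (id ⊗₁ ι k)                                ≈⟨ mulₙ-is-copairʳ ⟩∘⟨refl ⟩
    copairʳ (λ j → ι (n + j) ∘ app n j) ∘ (id ⊗₁ ι k)  ≈⟨ copairʳ-β k ⟩
    ι (n + k) ∘ app n k                                 ∎
    where
    mulₙ-is-copairʳ : mulₙ n ≈ copairʳ (λ j → ι (n + j) ∘ app n j)
    mulₙ-is-copairʳ =
      refl⟩∘⟨ ⊗-resp-≈ (copair-cong (λ _ → curry-cong (sym assoc))) refl ⟩∘⟨refl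

  mX-β : (n k : ℕ) → mX ∘ (ι n ⊗₁ ι k) ≈ ι (n + k) ∘ app n k
  mX-β n k = begin
    mX ∘ (ι n ⊗₁ ι k)                      ≈⟨ refl⟩∘⟨ ⊗id-∘-id⊗ ⟨
    uncurry γ ∘ (ι n ⊗₁ id) ∘ (id ⊗₁ ι k)  ≈⟨ assoc ⟨
    (uncurry γ ∘ (ι n ⊗₁ id)) ∘ (id ⊗₁ ι k) ≈⟨ sym uncurry-∘ ⟩∘⟨refl ⟩
    uncurry (γ ∘ ι n) ∘ (id ⊗₁ ι k)        ≈⟨ uncurry-cong (copair-β n) ⟩∘⟨refl ⟩
    uncurry (curry (mulₙ n)) ∘ (id ⊗₁ ι k) ≈⟨ uncurry-curry ⟩∘⟨refl ⟩
    mulₙ n ∘ (id ⊗₁ ι k)                   ≈⟨ mulₙ-β n k ⟩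
    ι (n + k) ∘ app n k                    ∎
    where
    γ : X* ⇒ [ X* , X* ]
    γ = copair (λ n → curry (mulₙ n))

  -- Prepending a letter to a word of length n gives a word of length n+1;
  -- the coherence isomorphism app 1 n is the identity by the triangle law.
  mX-prepend : (n : ℕ) → mX ∘ (ηX ⊗₁ ι n) ≈ ι (suc n)
  mX-prepend n = begin
    mX ∘ (ηX ⊗₁ ι n)                              ≈⟨ refl⟩∘⟨ split ⟩
    mX ∘ (ι 1 ⊗₁ ι n) ∘ (ρ⇐ ⊗₁ id)                ≈⟨ assoc ⟨
    (mX ∘ (ι 1 ⊗₁ ι n)) ∘ (ρ⇐ ⊗₁ id)              ≈⟨ mX-β 1 n ⟩∘⟨refl ⟩
    (ι (suc n) ∘ app 1 n) ∘ (ρ⇐ ⊗₁ id)            ≈⟨ assoc ⟩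
    ι (suc n) ∘ ((id ⊗₁ λ⇒) ∘ α⇒) ∘ (ρ⇐ ⊗₁ id)    ≈⟨ refl⟩∘⟨ triangle ⟩∘⟨refl ⟩
    ι (suc n) ∘ (ρ⇒ ⊗₁ id) ∘ (ρ⇐ ⊗₁ id)           ≈⟨ refl⟩∘⟨ ⊗-∘ ⟩
    ι (suc n) ∘ ((ρ⇒ ∘ ρ⇐) ⊗₁ (id ∘ id))          ≈⟨ refl⟩∘⟨ ⊗-resp-≈ ρ-isoʳ identityˡ ⟩
    ι (suc n) ∘ (id ⊗₁ id)                        ≈⟨ refl⟩∘⟨ ⊗-identity ⟩
    ι (suc n) ∘ id                                ≈⟨ identityʳ ⟩
    ι (suc n)                                     ∎
    where
    split : ηX ⊗₁ ι n ≈ (ι 1 ⊗₁ ι n) ∘ (ρ⇐ ⊗₁ id)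
    split = trans (⊗-resp-≈ refl (sym identityʳ)) ⊗-homomorphism

  component : ∀ {Q} → Q ⇒ W → (n : ℕ) → Q ⊗₀ pow n ⇒ Y
  component k n = uncurry k ∘ (id ⊗₁ ι n)

  components-determine : ∀ {Q} {k k' : Q ⇒ W} →
                         ((n : ℕ) → component k n ≈ component k' n) → k ≈ k'
  components-determine agree = uncurry-injective (tensor-jointly-epic agree)

  fW-component : ∀ {Q} (k : Q ⇒ W) → fW ∘ k ≈ component k 0 ∘ ρ⇐
  fW-component k = begin
    fW ∘ k                                   ≈⟨ assoc² ⟩
    ev ∘ (id ⊗₁ iX) ∘ ρ⇐ ∘ k                 ≈⟨ refl⟩∘⟨ refl⟩∘⟨ ρ⇐-natural ⟩
    ev ∘ (id ⊗₁ iX) ∘ (k ⊗₁ id) ∘ ρ⇐         ≈⟨ refl⟩∘⟨ sym assoc ⟩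
    ev ∘ ((id ⊗₁ iX) ∘ (k ⊗₁ id)) ∘ ρ⇐       ≈⟨ refl⟩∘⟨ ⊗-interchange ⟩∘⟨refl ⟩
    ev ∘ ((k ⊗₁ id) ∘ (id ⊗₁ iX)) ∘ ρ⇐       ≈⟨ refl⟩∘⟨ assoc ⟩
    ev ∘ (k ⊗₁ id) ∘ (id ⊗₁ iX) ∘ ρ⇐         ≈⟨ trans assoc assoc ⟨
    component k 0 ∘ ρ⇐                       ∎

  prepend : (W ⊗₀ X) ⊗₀ X* ⇒ W ⊗₀ X*
  prepend = (id ⊗₁ mX) ∘ α⇒ ∘ ((id ⊗₁ ηX) ⊗₁ id)

  uncurry²-τW : ∀ {Q} (k : Q ⇒ W) →
                uncurry (uncurry (τW ∘ k)) ≈ (ev ∘ prepend) ∘ ((k ⊗₁ id) ⊗₁ id)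
  uncurry²-τW k = begin
    uncurry (uncurry (τW ∘ k))                     ≈⟨ uncurry-cong uncurry-∘ ⟩
    uncurry (uncurry τW ∘ (k ⊗₁ id))               ≈⟨ uncurry-cong (uncurry-curry ⟩∘⟨refl) ⟩
    uncurry (curry (ev ∘ prepend) ∘ (k ⊗₁ id))     ≈⟨ uncurry-∘ ⟩
    uncurry (curry (ev ∘ prepend)) ∘ ((k ⊗₁ id) ⊗₁ id) ≈⟨ uncurry-curry ⟩∘⟨refl ⟩
    (ev ∘ prepend) ∘ ((k ⊗₁ id) ⊗₁ id)             ∎

  prepend-β : ∀ {Q} (k : Q ⇒ W) (n : ℕ) →
              prepend ∘ ((k ⊗₁ id) ⊗₁ ι n) ≈ ((k ⊗₁ id) ∘ (id ⊗₁ ι (suc n))) ∘ α⇒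
  prepend-β k n = begin
    prepend ∘ ((k ⊗₁ id) ⊗₁ ι n)                      ≈⟨ assoc² ⟩
    (id ⊗₁ mX) ∘ α⇒ ∘ ((id ⊗₁ ηX) ⊗₁ id) ∘ ((k ⊗₁ id) ⊗₁ ι n)
        ≈⟨ refl⟩∘⟨ refl⟩∘⟨ trans ⊗-∘ (⊗-resp-≈ id⊗-∘-⊗id identityˡ) ⟩
    (id ⊗₁ mX) ∘ α⇒ ∘ ((k ⊗₁ ηX) ⊗₁ ι n)              ≈⟨ refl⟩∘⟨ α-natural ⟩
    (id ⊗₁ mX) ∘ (k ⊗₁ (ηX ⊗₁ ι n)) ∘ α⇒              ≈⟨ sym assoc ⟩
    ((id ⊗₁ mX) ∘ (k ⊗₁ (ηX ⊗₁ ι n))) ∘ α⇒            ≈⟨ ⊗-∘ ⟩∘⟨refl ⟩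
    ((id ∘ k) ⊗₁ (mX ∘ (ηX ⊗₁ ι n))) ∘ α⇒             ≈⟨ ⊗-resp-≈ identityˡ (mX-prepend n) ⟩∘⟨refl ⟩
    (k ⊗₁ ι (suc n)) ∘ α⇒                             ≈⟨ ⊗id-∘-id⊗ ⟩∘⟨refl ⟨
    ((k ⊗₁ id) ∘ (id ⊗₁ ι (suc n))) ∘ α⇒              ∎

  τW-component : ∀ {Q} (k : Q ⇒ W) (n : ℕ) →
                 uncurry (uncurry (τW ∘ k)) ∘ (id ⊗₁ ι n) ≈ component k (suc n) ∘ α⇒
  τW-component k n = begin
    uncurry (uncurry (τW ∘ k)) ∘ (id ⊗₁ ι n)              ≈⟨ uncurry²-τW k ⟩∘⟨refl ⟩
    ((ev ∘ prepend) ∘ ((k ⊗₁ id) ⊗₁ id)) ∘ (id ⊗₁ ι n)    ≈⟨ assoc ⟩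
    (ev ∘ prepend) ∘ ((k ⊗₁ id) ⊗₁ id) ∘ (id ⊗₁ ι n)      ≈⟨ refl⟩∘⟨ ⊗id-∘-id⊗ ⟩
    (ev ∘ prepend) ∘ ((k ⊗₁ id) ⊗₁ ι n)                   ≈⟨ assoc ⟩
    ev ∘ prepend ∘ ((k ⊗₁ id) ⊗₁ ι n)                     ≈⟨ refl⟩∘⟨ prepend-β k n ⟩
    ev ∘ ((k ⊗₁ id) ∘ (id ⊗₁ ι (suc n))) ∘ α⇒             ≈⟨ trans (sym assoc) (sym assoc ⟩∘⟨refl) ⟩
    component k (suc n) ∘ α⇒                              ∎

  [X,-]-component : ∀ {Q Q'} (t : Q ⇒ [ X , Q' ]) (k : Q' ⇒ W) (n : ℕ) →
                    uncurry (uncurry ([X, k ]₁ ∘ t)) ∘ (id ⊗₁ ι n)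
                      ≈ component k n ∘ (uncurry t ⊗₁ id)
  [X,-]-component t k n = begin
    uncurry (uncurry ([X, k ]₁ ∘ t)) ∘ (id ⊗₁ ι n)    ≈⟨ uncurry-cong transpose ⟩∘⟨refl ⟩
    uncurry (k ∘ uncurry t) ∘ (id ⊗₁ ι n)             ≈⟨ uncurry-∘ ⟩∘⟨refl ⟩
    (uncurry k ∘ (uncurry t ⊗₁ id)) ∘ (id ⊗₁ ι n)     ≈⟨ assoc ⟩
    uncurry k ∘ (uncurry t ⊗₁ id) ∘ (id ⊗₁ ι n)       ≈⟨ refl⟩∘⟨ ⊗-interchange ⟨
    uncurry k ∘ (id ⊗₁ ι n) ∘ (uncurry t ⊗₁ id)       ≈⟨ sym assoc ⟩
    component k n ∘ (uncurry t ⊗₁ id)                 ∎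
    where
    transpose : uncurry ([X, k ]₁ ∘ t) ≈ k ∘ uncurry t
    transpose = begin
      uncurry ([X, k ]₁ ∘ t)           ≈⟨ uncurry-∘ ⟩
      uncurry [X, k ]₁ ∘ (t ⊗₁ id)     ≈⟨ uncurry-curry ⟩∘⟨refl ⟩
      (k ∘ ev) ∘ (t ⊗₁ id)             ≈⟨ assoc ⟩
      k ∘ uncurry t                    ∎

  module Behaviour (A : Coalg) where
    open Coalg A

    step : Q ⊗₀ X ⇒ Q
    step = uncurry τ

    behaviour : (n : ℕ) → Q ⊗₀ pow n ⇒ Y
    behaviour zero    = f ∘ ρ⇒
    behaviour (suc n) = behaviour n ∘ (step ⊗₁ id) ∘ α⇐

    hom-components : (g : CoalgHom A wordCoalg) (n : ℕ) →
                     component (CoalgHom.h g) n ≈ behaviour n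
    hom-components g zero =
      move-iso ρ-isoˡ (trans (sym (fW-component (CoalgHom.h g))) (CoalgHom.f-hom g))
    hom-components g (suc n) = trans (move-iso α-isoʳ (begin
      component h (suc n) ∘ α⇒                        ≈⟨ τW-component h n ⟨
      uncurry (uncurry (τW ∘ h)) ∘ (id ⊗₁ ι n)        ≈⟨ uncurry-cong (uncurry-cong τ-hom) ⟩∘⟨refl ⟩
      uncurry (uncurry ([X, h ]₁ ∘ τ)) ∘ (id ⊗₁ ι n)  ≈⟨ [X,-]-component τ h n ⟩
      component h n ∘ (step ⊗₁ id)                    ≈⟨ hom-components g n ⟩∘⟨refl ⟩
      behaviour n ∘ (step ⊗₁ id)                      ∎)) assoc
      where open CoalgHom g using (h; τ-hom)

    components-hom : (k : Q ⇒ W) → ((n : ℕ) → component k n ≈ behaviour n) →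
                     CoalgHom A wordCoalg
    components-hom k agree = record { h = k ; f-hom = f-hom ; τ-hom = τ-hom }
      where
      f-hom : fW ∘ k ≈ f
      f-hom = trans (fW-component k) (trans (agree 0 ⟩∘⟨refl) (cancelʳ ρ-isoʳ))
      τ-hom : τW ∘ k ≈ [X, k ]₁ ∘ τ
      τ-hom = uncurry-injective (uncurry-injective (tensor-jointly-epic λ n → begin
        uncurry (uncurry (τW ∘ k)) ∘ (id ⊗₁ ι n)        ≈⟨ τW-component k n ⟩
        component k (suc n) ∘ α⇒                        ≈⟨ agree (suc n) ⟩∘⟨refl ⟩
        (behaviour n ∘ (step ⊗₁ id) ∘ α⇐) ∘ α⇒          ≈⟨ sym assoc ⟩∘⟨refl ⟩
        ((behaviour n ∘ (step ⊗₁ id)) ∘ α⇐) ∘ α⇒        ≈⟨ cancelʳ α-isoˡ ⟩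
        behaviour n ∘ (step ⊗₁ id)                      ≈⟨ agree n ⟩∘⟨refl ⟨
        component k n ∘ (step ⊗₁ id)                    ≈⟨ [X,-]-component τ k n ⟨
        uncurry (uncurry ([X, k ]₁ ∘ τ)) ∘ (id ⊗₁ ι n)  ∎))

    unfold : Q ⇒ W
    unfold = curry (copairʳ behaviour)

    unfold-components : (n : ℕ) → component unfold n ≈ behaviour n
    unfold-components n = trans (uncurry-curry ⟩∘⟨refl) (copairʳ-β n)

  isFinal : IsFinal wordCoalg
  isFinal A = components-hom unfold unfold-components , unique
    where
    open Behaviour A
    unique : (g g' : CoalgHom A wordCoalg) → CoalgHom.h g ≈ CoalgHom.h g'
    unique g g' = components-determine λ n →
      trans (hom-components g n) (sym (hom-components g' n))

proposition2p25 : ∀ {o ℓ e} (𝒞 : Category o ℓ e) (M : SymmetricMonoidalClosed 𝒞)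
                    (K : CountableCoproducts 𝒞) (P : BinaryProducts 𝒞)
                    (X Y : Category.Obj 𝒞) →
                    Construction.IsFinal 𝒞 M K X Y (Construction.wordCoalg 𝒞 M K X Y)
proposition2p25 𝒞 M K _ X Y = WordCoalgebra.isFinal 𝒞 M K X Y
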